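{- For all integers $n\ge1$ and $m\in\mathbb{Z}$, \[ \sum_{l=1}^{n}(-1)^l\binom{n}{l}\,l\,F_{n+1}^{(l+m)}=\tfrac12(-1)^n(2m+n+1)\,n\,n!, \qquad \sum_{l=1}^{n}(-1)^l\binom{n}{l}\,l\,F_{n+1}^{(lm)}=\tfrac12(-1)^n m^n\,n\,(n+1)!. \]
   Context: For $p\in\mathbb{Z}$, the generalized Fibonacci numbers $F_k^{(p)}$ are defined by $F_0^{(p)}=0$, $F_1^{(p)}=1$, $F_k^{(p)}=pF_{k-1}^{(p)}+F_{k-2}^{(p)}$ for $k\ge2$. (Equivalently $F_{n+1}^{(m)}=\prod_{l=1}^n\bigl(m-2i\cos\frac{l\pi}{n+1}\bigr)$.) -}

module Defs where

open import Data.Nat as ℕ using (ℕ; zero; suc)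
open import Data.Nat.Combinatorics using (_C_)
open import Data.Nat.Base using (_!)
open import Data.Integer using (ℤ; +_; _+_; _*_; -_; 0ℤ; 1ℤ)

F : ℤ → ℕ → ℤ
F p zero = 0ℤ
F p (suc zero) = 1ℤ
F p (suc (suc k)) = p * F p (suc k) + F p k

sgn : ℕ → ℤ
sgn zero = 1ℤ
sgn (suc k) = - sgn k

sumFrom1 : ℕ → (ℕ → ℤ) → ℤ
sumFrom1 zero f = 0ℤ
sumFrom1 (suc n) f = sumFrom1 n f + f (suc n)

-- F_{n+1}^{(p)} is a monic polynomial of degree n in p without a p^{n-1} term, so for p = c l + d
-- the function l ↦ 2 F_{n+1}(c l + d) expands in the binomial basis l ↦ C(l, k) as
-- lead · C(l, n) + sublead · C(l, n - 1) + (degree < n - 1); both coefficients are tracked through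
-- the recurrence F_{k+2} = p F_{k+1} + F_k using l · C(l, k) = (k + 1) C(l, k + 1) + k C(l, k).
-- Multiplying by l raises the expansion by one step, and the alternating binomial sum
-- Σ (-1)^l C(n, l) g(l) = (-1)^n (Δ^n g)(0) kills C(l, n + 1) and all of degree < n while sending
-- C(l, n) to 1. The sum is therefore (-1)^n n (lead + sublead), where lead = 2 n! c^n and
-- sublead = n! c^{n-1} ((n - 1) c + 2 d).
module Submission where

open import Defs
open import Data.Nat as ℕ using (ℕ; zero; suc; _≥_; _!; s≤s; z≤n)
import Data.Nat.Properties as ℕ
open import Data.Nat.Combinatorics using (_C_; nCk+nC[k+1]≡[n+1]C[k+1]; nC1≡n)
open import Data.Nat.Combinatorics.Specification using (k>n⇒nCk≡0)
open import Data.Nat.Tactic.RingSolver using () renaming (solve-∀ to ℕ-solve-∀)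
open import Data.Integer using (ℤ; +_; _+_; _*_; _^_; -_; _-_; 0ℤ; 1ℤ)
open import Data.Integer.Properties using (pos-*; pos-+; *-zeroʳ; *-identityˡ; *-distribˡ-+; +-assoc; +-identityʳ; ^-zeroˡ)
open import Data.Integer.Tactic.RingSolver using (solve-∀)
open import Data.Product using (_×_; _,_)
open import Function using (_∘_)
open import Relation.Binary.PropositionalEquality

Δ : (ℕ → ℤ) → ℕ → ℤ
Δ f l = f (suc l) - f l

Δ^ : ℕ → (ℕ → ℤ) → ℕ → ℤ
Δ^ zero    f = f
Δ^ (suc k) f = Δ^ k (Δ f)

record Degree< (k : ℕ) (f : ℕ → ℤ) : Set where
  constructor degree<
  field Δ^-vanishes : ∀ l → Δ^ k f l ≡ 0ℤ

Δ^-cong : ∀ k {f g : ℕ → ℤ} → f ≗ g → Δ^ k f ≗ Δ^ k g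
Δ^-cong zero    f≗g = f≗g
Δ^-cong (suc k) f≗g = Δ^-cong k (λ l → cong₂ _-_ (f≗g (suc l)) (f≗g l))

Δ^-+ : ∀ k (f g : ℕ → ℤ) → Δ^ k (λ l → f l + g l) ≗ λ l → Δ^ k f l + Δ^ k g l
Δ^-+ zero    f g l = refl
Δ^-+ (suc k) f g l =
  trans (Δ^-cong k (λ l → regroup (f (suc l)) (f l) (g (suc l)) (g l)) l) (Δ^-+ k (Δ f) (Δ g) l)
  where
  regroup : ∀ a b c d → (a + c) - (b + d) ≡ (a - b) + (c - d)
  regroup = solve-∀

Δ^-* : ∀ k (c : ℤ) (f : ℕ → ℤ) → Δ^ k (λ l → c * f l) ≗ λ l → c * Δ^ k f l
Δ^-* zero    c f l = refl
Δ^-* (suc k) c f l =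
  trans (Δ^-cong k (λ l → factor c (f (suc l)) (f l)) l) (Δ^-* k c (Δ f) l)
  where
  factor : ∀ c a b → c * a - c * b ≡ c * (a - b)
  factor = solve-∀

Δ^-shift : ∀ k (f : ℕ → ℤ) → Δ^ k (f ∘ suc) ≗ Δ^ k f ∘ suc
Δ^-shift zero    f l = refl
Δ^-shift (suc k) f l = Δ^-shift k (Δ f) l

Δ^-Δ : ∀ k (f : ℕ → ℤ) → Δ^ k (Δ f) ≗ Δ (Δ^ k f)
Δ^-Δ zero    f l = refl
Δ^-Δ (suc k) f l = Δ^-Δ k (Δ f) l

Degree<-cong : ∀ k {f g : ℕ → ℤ} → f ≗ g → Degree< k f → Degree< k g
Degree<-cong k f≗g (degree< df) = degree< λ l → trans (sym (Δ^-cong k f≗g l)) (df l)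

Degree<-+ : ∀ k {f g : ℕ → ℤ} → Degree< k f → Degree< k g → Degree< k (λ l → f l + g l)
Degree<-+ k {f} {g} (degree< df) (degree< dg) =
  degree< λ l → trans (Δ^-+ k f g l) (cong₂ _+_ (df l) (dg l))

Degree<-* : ∀ k (c : ℤ) {f : ℕ → ℤ} → Degree< k f → Degree< k (λ l → c * f l)
Degree<-* k c {f} (degree< df) =
  degree< λ l → trans (Δ^-* k c f l) (trans (cong (c *_) (df l)) (*-zeroʳ c))

Degree<-shift : ∀ k {f : ℕ → ℤ} → Degree< k f → Degree< k (f ∘ suc)
Degree<-shift k {f} (degree< df) = degree< λ l → trans (Δ^-shift k f l) (df (suc l))

Degree<-suc : ∀ k {f : ℕ → ℤ} → Degree< k f → Degree< (suc k) f
Degree<-suc k {f} (degree< df) = degree< λ l → trans (Δ^-Δ k f l) (cong₂ _-_ (df (suc l)) (df l))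

Degree<-Δ : ∀ k {f : ℕ → ℤ} → Degree< k (Δ f) → Degree< (suc k) f
Degree<-Δ k (degree< dΔf) = degree< dΔf

Δ-Degree< : ∀ k {f : ℕ → ℤ} → Degree< (suc k) f → Degree< k (Δ f)
Δ-Degree< k (degree< df) = degree< df

Δ-id* : ∀ (f : ℕ → ℤ) l → Δ (λ l → + l * f l) l ≡ + l * Δ f l + f (suc l)
Δ-id* f l = expand (+ l) (f (suc l)) (f l)
  where
  -- + suc l reduces to 1ℤ + + l, so solver lemmas phrased with 1ℤ + L apply to it directly.
  expand : ∀ L a b → (1ℤ + L) * a - L * b ≡ L * (a - b) + a
  expand = solve-∀

Degree<-id* : ∀ k {f : ℕ → ℤ} → Degree< k f → Degree< (suc k) (λ l → + l * f l)
Degree<-id* k {f} df =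
  Degree<-Δ k (Degree<-cong k (sym ∘ Δ-id* f) (Degree<-+ k (id*Δ k df) (Degree<-shift k df)))
  where
  id*Δ : ∀ k → Degree< k f → Degree< k (λ l → + l * Δ f l)
  id*Δ zero    (degree< df) = degree< λ l →
    trans (cong (+ l *_) (cong₂ _-_ (df (suc l)) (df l))) (*-zeroʳ (+ l))
  id*Δ (suc k) df = Degree<-id* k (Δ-Degree< k df)

C[_] : ℕ → ℕ → ℤ
C[ k ] l = + (l C k)

Δ-binomial : ∀ k → Δ C[ suc k ] ≗ C[ k ]
Δ-binomial k l = begin
  + (suc l C suc k) - C[ suc k ] l           ≡⟨ cong (λ z → + z - C[ suc k ] l) (sym (nCk+nC[k+1]≡[n+1]C[k+1] l k)) ⟩
  (C[ k ] l + C[ suc k ] l) - C[ suc k ] l   ≡⟨ cancel (C[ k ] l) (C[ suc k ] l) ⟩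
  C[ k ] l                                   ∎
  where
  open ≡-Reasoning
  cancel : ∀ a b → (a + b) - b ≡ a
  cancel = solve-∀

Δ^-binomial : ∀ k j → Δ^ k C[ j ℕ.+ k ] ≗ C[ j ]
Δ^-binomial zero    j l = cong (λ i → C[ i ] l) (ℕ.+-identityʳ j)
Δ^-binomial (suc k) j l = trans (Δ^-cong k Δ-top l) (Δ^-binomial k j l)
  where
  Δ-top : Δ C[ j ℕ.+ suc k ] ≗ C[ j ℕ.+ k ]
  Δ-top rewrite ℕ.+-suc j k = Δ-binomial (j ℕ.+ k)

Degree<-binomial : ∀ k → Degree< (suc k) C[ k ]
Degree<-binomial zero    = degree< λ l → refl
Degree<-binomial (suc k) = Degree<-Δ (suc k) (Degree<-cong (suc k) (sym ∘ Δ-binomial k) (Degree<-binomial k))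

n*nCk≡[1+k]*nC[1+k]+k*nCk : ∀ n k → n ℕ.* (n C k) ≡ suc k ℕ.* (n C suc k) ℕ.+ k ℕ.* (n C k)
n*nCk≡[1+k]*nC[1+k]+k*nCk n       zero    =
  trans (ℕ.*-identityʳ n) (sym (trans (ℕ.+-identityʳ _) (trans (ℕ.+-identityʳ _) (nC1≡n n))))
n*nCk≡[1+k]*nC[1+k]+k*nCk zero    (suc k) = sym (cong₂ ℕ._+_ (ℕ.*-zeroʳ (suc (suc k))) (ℕ.*-zeroʳ (suc k)))
n*nCk≡[1+k]*nC[1+k]+k*nCk (suc n) (suc k) = begin
  suc n ℕ.* (suc n C suc k)                                    ≡⟨ cong (suc n ℕ.*_) (sym (pascal k)) ⟩
  suc n ℕ.* (C₀ ℕ.+ C₁)                                        ≡⟨ distrib n C₀ C₁ ⟩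
  (n ℕ.* C₀ ℕ.+ n ℕ.* C₁) ℕ.+ (C₀ ℕ.+ C₁)                      ≡⟨ cong₂ (λ u v → (u ℕ.+ v) ℕ.+ (C₀ ℕ.+ C₁))
                                                                    (n*nCk≡[1+k]*nC[1+k]+k*nCk n k)
                                                                    (n*nCk≡[1+k]*nC[1+k]+k*nCk n (suc k)) ⟩
  (suc k ℕ.* C₁ ℕ.+ k ℕ.* C₀ ℕ.+ (suc (suc k) ℕ.* C₂ ℕ.+ suc k ℕ.* C₁)) ℕ.+ (C₀ ℕ.+ C₁)
                                                               ≡⟨ regroup k C₀ C₁ C₂ ⟩
  suc (suc k) ℕ.* (C₁ ℕ.+ C₂) ℕ.+ suc k ℕ.* (C₀ ℕ.+ C₁)        ≡⟨ cong₂ (λ u v → suc (suc k) ℕ.* u ℕ.+ suc k ℕ.* v)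
                                                                    (pascal (suc k)) (pascal k) ⟩
  suc (suc k) ℕ.* (suc n C suc (suc k)) ℕ.+ suc k ℕ.* (suc n C suc k) ∎
  where
  open ≡-Reasoning
  pascal : ∀ k → n C k ℕ.+ n C suc k ≡ suc n C suc k
  pascal = nCk+nC[k+1]≡[n+1]C[k+1] n
  C₀ C₁ C₂ : ℕ
  C₀ = n C k
  C₁ = n C suc k
  C₂ = n C suc (suc k)
  distrib : ∀ n a b → suc n ℕ.* (a ℕ.+ b) ≡ (n ℕ.* a ℕ.+ n ℕ.* b) ℕ.+ (a ℕ.+ b)
  distrib = ℕ-solve-∀
  regroup : ∀ k a b c → (suc k ℕ.* b ℕ.+ k ℕ.* a ℕ.+ (suc (suc k) ℕ.* c ℕ.+ suc k ℕ.* b)) ℕ.+ (a ℕ.+ b)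
                      ≡ suc (suc k) ℕ.* (b ℕ.+ c) ℕ.+ suc k ℕ.* (a ℕ.+ b)
  regroup = ℕ-solve-∀

id*binomial : ∀ k l → + l * C[ k ] l ≡ + suc k * C[ suc k ] l + + k * C[ k ] l
id*binomial k l = begin
  + l * + (l C k)                                        ≡⟨ sym (pos-* l (l C k)) ⟩
  + (l ℕ.* (l C k))                                      ≡⟨ cong +_ (n*nCk≡[1+k]*nC[1+k]+k*nCk l k) ⟩
  + (suc k ℕ.* (l C suc k) ℕ.+ k ℕ.* (l C k))            ≡⟨ pos-+ (suc k ℕ.* (l C suc k)) (k ℕ.* (l C k)) ⟩
  + (suc k ℕ.* (l C suc k)) + + (k ℕ.* (l C k))          ≡⟨ cong₂ _+_ (pos-* (suc k) (l C suc k)) (pos-* k (l C k)) ⟩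
  + suc k * + (l C suc k) + + k * + (l C k)              ∎
  where open ≡-Reasoning

Σ≤ : ℕ → (ℕ → ℤ) → ℤ
Σ≤ zero    f = f 0
Σ≤ (suc n) f = Σ≤ n f + f (suc n)

Σ≤-cong : ∀ n {f g : ℕ → ℤ} → f ≗ g → Σ≤ n f ≡ Σ≤ n g
Σ≤-cong zero    f≗g = f≗g 0
Σ≤-cong (suc n) f≗g = cong₂ _+_ (Σ≤-cong n f≗g) (f≗g (suc n))

Σ≤-+ : ∀ n (f g : ℕ → ℤ) → Σ≤ n (λ l → f l + g l) ≡ Σ≤ n f + Σ≤ n g
Σ≤-+ zero    f g = refl
Σ≤-+ (suc n) f g =
  trans (cong (_+ (f (suc n) + g (suc n))) (Σ≤-+ n f g)) (swap (Σ≤ n f) (Σ≤ n g) (f (suc n)) (g (suc n)))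
  where
  swap : ∀ a b c d → (a + b) + (c + d) ≡ (a + c) + (b + d)
  swap = solve-∀

Σ≤-* : ∀ n (c : ℤ) (f : ℕ → ℤ) → Σ≤ n (λ l → c * f l) ≡ c * Σ≤ n f
Σ≤-* zero    c f = refl
Σ≤-* (suc n) c f =
  trans (cong (_+ c * f (suc n)) (Σ≤-* n c f)) (sym (*-distribˡ-+ c (Σ≤ n f) (f (suc n))))

Σ≤-shift : ∀ n (f : ℕ → ℤ) → Σ≤ (suc n) f ≡ f 0 + Σ≤ n (f ∘ suc)
Σ≤-shift zero    f = refl
Σ≤-shift (suc n) f =
  trans (cong (_+ f (suc (suc n))) (Σ≤-shift n f)) (+-assoc (f 0) (Σ≤ n (f ∘ suc)) (f (suc (suc n))))

Σ≤≡sumFrom1 : ∀ n {f : ℕ → ℤ} → f 0 ≡ 0ℤ → Σ≤ n f ≡ sumFrom1 n f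
Σ≤≡sumFrom1 zero    f0≡0 = f0≡0
Σ≤≡sumFrom1 (suc n) {f} f0≡0 = cong (_+ f (suc n)) (Σ≤≡sumFrom1 n f0≡0)

alternatingSum : ℕ → (ℕ → ℤ) → ℤ
alternatingSum n f = Σ≤ n (λ l → sgn l * + (n C l) * f l)

alternatingSum-suc : ∀ n (f : ℕ → ℤ) →
                     alternatingSum (suc n) f ≡ alternatingSum n f - alternatingSum n (f ∘ suc)
alternatingSum-suc n f = begin
  alternatingSum (suc n) f                                 ≡⟨ Σ≤-shift n _ ⟩
  t 0 + Σ≤ n (λ l → sgn (suc l) * + (suc n C suc l) * f (suc l))
                                                           ≡⟨ cong (_+_ (t 0)) (Σ≤-cong n split) ⟩
  t 0 + Σ≤ n (λ l → t (suc l) + (- 1ℤ) * v l)              ≡⟨ cong (_+_ (t 0)) (trans (Σ≤-+ n (t ∘ suc) _)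
                                                                 (cong (_+_ (Σ≤ n (t ∘ suc))) (Σ≤-* n (- 1ℤ) v))) ⟩
  t 0 + (Σ≤ n (t ∘ suc) + (- 1ℤ) * Σ≤ n v)                 ≡⟨ regroup (t 0) (Σ≤ n (t ∘ suc)) (Σ≤ n v) ⟩
  (t 0 + Σ≤ n (t ∘ suc)) - Σ≤ n v                          ≡⟨ cong (_- Σ≤ n v) (sym (Σ≤-shift n t)) ⟩
  (alternatingSum n f + t (suc n)) - Σ≤ n v                ≡⟨ cong (λ z → (alternatingSum n f + z) - Σ≤ n v) top≡0 ⟩
  (alternatingSum n f + 0ℤ) - Σ≤ n v                       ≡⟨ cong (_- Σ≤ n v) (+-identityʳ (alternatingSum n f)) ⟩
  alternatingSum n f - alternatingSum n (f ∘ suc)          ∎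
  where
  open ≡-Reasoning
  t v : ℕ → ℤ
  t l = sgn l * + (n C l) * f l
  v l = sgn l * + (n C l) * f (suc l)
  distribute : ∀ s a b g → (- s) * (a + b) * g ≡ (- s) * b * g + (- 1ℤ) * (s * a * g)
  distribute = solve-∀
  split : ∀ l → sgn (suc l) * + (suc n C suc l) * f (suc l) ≡ t (suc l) + (- 1ℤ) * v l
  split l = trans (cong (λ z → sgn (suc l) * + z * f (suc l)) (sym (nCk+nC[k+1]≡[n+1]C[k+1] n l)))
                  (distribute (sgn l) (+ (n C l)) (+ (n C suc l)) (f (suc l)))
  regroup : ∀ a b c → a + (b + (- 1ℤ) * c) ≡ (a + b) - c
  regroup = solve-∀
  top≡0 : t (suc n) ≡ 0ℤ
  top≡0 = trans (cong (λ z → sgn (suc n) * + z * f (suc n)) (k>n⇒nCk≡0 (ℕ.n<1+n n)))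
                (cong (_* f (suc n)) (*-zeroʳ (sgn (suc n))))

alternatingSum≡sgn*Δ^ : ∀ n (f : ℕ → ℤ) → alternatingSum n f ≡ sgn n * Δ^ n f 0
alternatingSum≡sgn*Δ^ zero    f = refl
alternatingSum≡sgn*Δ^ (suc n) f = begin
  alternatingSum (suc n) f                         ≡⟨ alternatingSum-suc n f ⟩
  alternatingSum n f - alternatingSum n (f ∘ suc)  ≡⟨ cong₂ _-_ (alternatingSum≡sgn*Δ^ n f)
                                                       (trans (alternatingSum≡sgn*Δ^ n (f ∘ suc))
                                                              (cong (sgn n *_) (Δ^-shift n f 0))) ⟩
  sgn n * Δ^ n f 0 - sgn n * Δ^ n f 1              ≡⟨ factor (sgn n) (Δ^ n f 0) (Δ^ n f 1) ⟩
  - sgn n * Δ (Δ^ n f) 0                           ≡⟨ cong (- sgn n *_) (sym (Δ^-Δ n f 0)) ⟩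
  sgn (suc n) * Δ^ (suc n) f 0                     ∎
  where
  open ≡-Reasoning
  factor : ∀ s a b → s * a - s * b ≡ - s * (b - a)
  factor = solve-∀

record TopCoeffs (k : ℕ) (a b : ℤ) (f : ℕ → ℤ) : Set where
  constructor topCoeffs
  field remainder : Degree< k (λ l → f l - a * C[ suc k ] l - b * C[ k ] l)

-- Via cong rather than by matching on refl, which would make Agda normalise the solver proofs passed in.
TopCoeffs-resp : ∀ k {a a′ b b′ : ℤ} {f g : ℕ → ℤ} →
                 a ≡ a′ → b ≡ b′ → f ≗ g → TopCoeffs k a b f → TopCoeffs k a′ b′ g
TopCoeffs-resp k a≡a′ b≡b′ f≗g (topCoeffs r) = topCoeffs (Degree<-cong k (λ l →
  cong₂ _-_ (cong₂ _-_ (f≗g l) (cong (_* C[ suc k ] l) a≡a′)) (cong (_* C[ k ] l) b≡b′)) r)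

TopCoeffs-+ : ∀ k {a a′ b b′ : ℤ} {f g : ℕ → ℤ} → TopCoeffs k a b f → TopCoeffs k a′ b′ g →
              TopCoeffs k (a + a′) (b + b′) (λ l → f l + g l)
TopCoeffs-+ k {a} {a′} {b} {b′} {f} {g} (topCoeffs r) (topCoeffs r′) = topCoeffs
  (Degree<-cong k (λ l → regroup (f l) (g l) a a′ b b′ (C[ suc k ] l) (C[ k ] l)) (Degree<-+ k r r′))
  where
  regroup : ∀ x y a a′ b b′ C₁ C₀ → (x - a * C₁ - b * C₀) + (y - a′ * C₁ - b′ * C₀)
                                   ≡ (x + y) - (a + a′) * C₁ - (b + b′) * C₀
  regroup = solve-∀

TopCoeffs-* : ∀ k (c : ℤ) {a b : ℤ} {f : ℕ → ℤ} → TopCoeffs k a b f →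
              TopCoeffs k (c * a) (c * b) (λ l → c * f l)
TopCoeffs-* k c {a} {b} {f} (topCoeffs r) = topCoeffs
  (Degree<-cong k (λ l → factor c (f l) a b (C[ suc k ] l) (C[ k ] l)) (Degree<-* k c r))
  where
  factor : ∀ c x a b C₁ C₀ → c * (x - a * C₁ - b * C₀) ≡ c * x - (c * a) * C₁ - (c * b) * C₀
  factor = solve-∀

x-0*y-0*z≡x : ∀ x y z → x - 0ℤ * y - 0ℤ * z ≡ x
x-0*y-0*z≡x = solve-∀

Degree<⇒TopCoeffs₀ : ∀ k {f : ℕ → ℤ} → Degree< k f → TopCoeffs k 0ℤ 0ℤ f
Degree<⇒TopCoeffs₀ k {f} df =
  topCoeffs (Degree<-cong k (λ l → sym (x-0*y-0*z≡x (f l) (C[ suc k ] l) (C[ k ] l))) df)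

TopCoeffs₀⇒Degree< : ∀ k {f : ℕ → ℤ} → TopCoeffs k 0ℤ 0ℤ f → Degree< k f
TopCoeffs₀⇒Degree< k {f} (topCoeffs r) =
  Degree<-cong k (λ l → x-0*y-0*z≡x (f l) (C[ suc k ] l) (C[ k ] l)) r

TopCoeffs-raise : ∀ k {a b : ℤ} {f : ℕ → ℤ} → TopCoeffs k a b f → TopCoeffs (suc k) 0ℤ a f
TopCoeffs-raise k {a} {b} {f} (topCoeffs r) = topCoeffs
  (Degree<-cong (suc k) (λ l → regroup (f l) a b (C[ suc (suc k) ] l) (C[ suc k ] l) (C[ k ] l))
    (Degree<-+ (suc k) (Degree<-suc k r) (Degree<-* (suc k) b (Degree<-binomial k))))
  where
  regroup : ∀ x a b C₂ C₁ C₀ → (x - a * C₁ - b * C₀) + b * C₀ ≡ x - 0ℤ * C₂ - a * C₁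
  regroup = solve-∀

TopCoeffs⇒Degree< : ∀ k {a b : ℤ} {f : ℕ → ℤ} → TopCoeffs k a b f → Degree< (suc (suc k)) f
TopCoeffs⇒Degree< k tf = TopCoeffs₀⇒Degree< (suc (suc k)) (TopCoeffs-raise (suc k) (TopCoeffs-raise k tf))

TopCoeffs-id* : ∀ k {a b : ℤ} {f : ℕ → ℤ} → TopCoeffs k a b f →
                TopCoeffs (suc k) (+ suc (suc k) * a) (+ suc k * (a + b)) (λ l → + l * f l)
TopCoeffs-id* k {a} {b} {f} (topCoeffs r) = topCoeffs
  (Degree<-cong (suc k) (sym ∘ remainder≡)
    (Degree<-+ (suc k) (Degree<-id* k r) (Degree<-* (suc k) (b * + k) (Degree<-binomial k))))
  where
  open ≡-Reasoning
  A B : ℤ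
  A = + suc (suc k) * a
  B = + suc k * (a + b)
  ρ : ℕ → ℤ
  ρ l = f l - a * C[ suc k ] l - b * C[ k ] l
  expand : ∀ L x a b A B C₂ C₁ C₀ →
           L * x - A * C₂ - B * C₁ ≡ L * (x - a * C₁ - b * C₀) + a * (L * C₁) + b * (L * C₀) - A * C₂ - B * C₁
  expand = solve-∀
  collect : ∀ L y a b K C₂ C₁ C₀ →
            L * y + a * ((1ℤ + (1ℤ + K)) * C₂ + (1ℤ + K) * C₁) + b * ((1ℤ + K) * C₁ + K * C₀)
              - (1ℤ + (1ℤ + K)) * a * C₂ - (1ℤ + K) * (a + b) * C₁
            ≡ L * y + b * K * C₀
  collect = solve-∀
  remainder≡ : ∀ l → + l * f l - A * C[ suc (suc k) ] l - B * C[ suc k ] l ≡ + l * ρ l + b * + k * C[ k ] l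
  remainder≡ l = begin
    + l * f l - A * C[ suc (suc k) ] l - B * C[ suc k ] l
      ≡⟨ expand (+ l) (f l) a b A B (C[ suc (suc k) ] l) (C[ suc k ] l) (C[ k ] l) ⟩
    + l * ρ l + a * (+ l * C[ suc k ] l) + b * (+ l * C[ k ] l) - A * C[ suc (suc k) ] l - B * C[ suc k ] l
      ≡⟨ cong₂ (λ u v → + l * ρ l + a * u + b * v - A * C[ suc (suc k) ] l - B * C[ suc k ] l)
               (id*binomial (suc k) l) (id*binomial k l) ⟩
    + l * ρ l + a * (+ suc (suc k) * C[ suc (suc k) ] l + + suc k * C[ suc k ] l)
              + b * (+ suc k * C[ suc k ] l + + k * C[ k ] l) - A * C[ suc (suc k) ] l - B * C[ suc k ] l
      ≡⟨ collect (+ l) (ρ l) a b (+ k) (C[ suc (suc k) ] l) (C[ suc k ] l) (C[ k ] l) ⟩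
    + l * ρ l + b * + k * C[ k ] l ∎

alternatingSum-TopCoeffs : ∀ n {a b : ℤ} {f : ℕ → ℤ} → TopCoeffs n a b f → alternatingSum n f ≡ sgn n * b
alternatingSum-TopCoeffs n {a} {b} {f} (topCoeffs (degree< ρ≡0)) =
  trans (alternatingSum≡sgn*Δ^ n f) (cong (sgn n *_) Δ^nf0≡b)
  where
  open ≡-Reasoning
  ρ : ℕ → ℤ
  ρ l = f l - a * C[ suc n ] l - b * C[ n ] l
  decompose : ∀ x a b C₁ C₀ → x ≡ (x - a * C₁ - b * C₀) + (a * C₁ + b * C₀)
  decompose = solve-∀
  evaluate : ∀ a b → 0ℤ + (a * 0ℤ + b * 1ℤ) ≡ b
  evaluate = solve-∀
  Δ^nf0≡b : Δ^ n f 0 ≡ b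
  Δ^nf0≡b = begin
    Δ^ n f 0
      ≡⟨ Δ^-cong n (λ l → decompose (f l) a b (C[ suc n ] l) (C[ n ] l)) 0 ⟩
    Δ^ n (λ l → ρ l + (a * C[ suc n ] l + b * C[ n ] l)) 0
      ≡⟨ trans (Δ^-+ n ρ _ 0) (cong₂ _+_ (ρ≡0 0) (Δ^-+ n _ _ 0)) ⟩
    0ℤ + (Δ^ n (λ l → a * C[ suc n ] l) 0 + Δ^ n (λ l → b * C[ n ] l) 0)
      ≡⟨ cong₂ (λ u v → 0ℤ + (u + v))
           (trans (Δ^-* n a C[ suc n ] 0) (cong (a *_) (Δ^-binomial n 1 0)))
           (trans (Δ^-* n b C[ n ] 0) (cong (b *_) (Δ^-binomial n 0 0))) ⟩
    0ℤ + (a * C[ 1 ] 0 + b * C[ 0 ] 0)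
      ≡⟨ evaluate a b ⟩
    b ∎

twice-sumFrom1≡alternatingSum : ∀ n (g : ℕ → ℤ) →
  + 2 * sumFrom1 n (λ l → sgn l * + (n C l) * + l * g l) ≡ alternatingSum n (λ l → + l * (+ 2 * g l))
twice-sumFrom1≡alternatingSum n g = begin
  + 2 * sumFrom1 n t                            ≡⟨ cong (+ 2 *_) (sym (Σ≤≡sumFrom1 n refl)) ⟩
  + 2 * Σ≤ n t                                  ≡⟨ sym (Σ≤-* n (+ 2) t) ⟩
  Σ≤ n (λ l → + 2 * t l)                        ≡⟨ Σ≤-cong n (λ l → rearrange (sgn l) (+ (n C l)) (+ l) (g l)) ⟩
  alternatingSum n (λ l → + l * (+ 2 * g l))    ∎
  where
  open ≡-Reasoning
  t : ℕ → ℤ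
  t l = sgn l * + (n C l) * + l * g l
  rearrange : ∀ s C L y → + 2 * (s * C * L * y) ≡ s * C * (L * (+ 2 * y))
  rearrange = solve-∀

module AffineFibonacci (x : ℕ → ℤ) (c d : ℤ) (x-affine : ∀ l → x l ≡ c * + l + d) where

  TopCoeffs-recurrence : ∀ k {a b : ℤ} {f g : ℕ → ℤ} → TopCoeffs k a b f → Degree< (suc k) g →
                         TopCoeffs (suc k) (c * (+ suc (suc k) * a)) (c * (+ suc k * (a + b)) + d * a)
                                   (λ l → x l * f l + g l)
  TopCoeffs-recurrence k {a} {b} {f} {g} tf dg =
    TopCoeffs-resp (suc k) (drop-zeros (c * (+ suc (suc k) * a)) d) (+-identityʳ _) x*f+g≗
      (TopCoeffs-+ (suc k)
        (TopCoeffs-+ (suc k) (TopCoeffs-* (suc k) c (TopCoeffs-id* k tf)) (TopCoeffs-* (suc k) d (TopCoeffs-raise k tf)))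
        (Degree<⇒TopCoeffs₀ (suc k) dg))
    where
    drop-zeros : ∀ u d → (u + d * 0ℤ) + 0ℤ ≡ u
    drop-zeros = solve-∀
    distribute : ∀ c d L y z → (c * (L * y) + d * y) + z ≡ (c * L + d) * y + z
    distribute = solve-∀
    x*f+g≗ : ∀ l → (c * (+ l * f l) + d * f l) + g l ≡ x l * f l + g l
    x*f+g≗ l = trans (distribute c d (+ l) (f l) (g l)) (cong (λ p → p * f l + g l) (sym (x-affine l)))

  -- Doubled because the coefficient of C(l, j) in F_{j+2}(x l) is (j+1)! c^j (j c / 2 + d).
  twiceF : ℕ → ℕ → ℤ
  twiceF n l = + 2 * F (x l) n

  lead sublead : ℕ → ℤ
  lead    j = + 2 * + (suc j !) * c ^ suc j
  sublead j = + (suc j !) * c ^ j * (c * + j + + 2 * d)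

  lead-suc : ∀ j → c * (+ suc (suc j) * lead j) ≡ lead (suc j)
  lead-suc j = trans (regroup c (+ j) (+ (suc j !)) (c ^ j))
                     (cong (λ z → + 2 * z * c ^ suc (suc j)) (sym (pos-* (suc (suc j)) (suc j !))))
    where
    regroup : ∀ c K F! cʲ → c * ((1ℤ + (1ℤ + K)) * (+ 2 * F! * (c * cʲ)))
                          ≡ + 2 * ((1ℤ + (1ℤ + K)) * F!) * (c * (c * cʲ))
    regroup = solve-∀

  sublead-suc : ∀ j → c * (+ suc j * (lead j + sublead j)) + d * lead j ≡ sublead (suc j)
  sublead-suc j = trans (regroup c d (+ j) (+ (suc j !)) (c ^ j))
                        (cong (λ z → z * c ^ suc j * (c * + suc j + + 2 * d)) (sym (pos-* (suc (suc j)) (suc j !))))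
    where
    regroup : ∀ c d K F! cʲ →
              c * ((1ℤ + K) * (+ 2 * F! * (c * cʲ) + F! * cʲ * (c * K + + 2 * d))) + d * (+ 2 * F! * (c * cʲ))
              ≡ (1ℤ + (1ℤ + K)) * F! * (c * cʲ) * (c * (1ℤ + K) + + 2 * d)
    regroup = solve-∀

  twiceF-suc : ∀ j l → x l * twiceF (suc (suc j)) l + twiceF (suc j) l ≡ twiceF (suc (suc (suc j))) l
  twiceF-suc j l = regroup (x l) (F (x l) (suc (suc j))) (F (x l) (suc j))
    where
    regroup : ∀ p a b → p * (+ 2 * a) + + 2 * b ≡ + 2 * (p * a + b)
    regroup = solve-∀

  twiceF-top    : ∀ j → TopCoeffs j (lead j) (sublead j) (twiceF (suc (suc j)))
  twiceF-degree : ∀ j → Degree< (suc j) (twiceF (suc j))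

  twiceF-degree zero    = degree< λ l → refl
  twiceF-degree (suc j) = TopCoeffs⇒Degree< j (twiceF-top j)

  twiceF-top zero = topCoeffs (degree< λ l →
    trans (cong₂ (λ p C → + 2 * (p * 1ℤ + 0ℤ) - lead 0 * + C - sublead 0 * 1ℤ) (x-affine l) (nC1≡n l))
          (cancel c d (+ l)))
    where
    cancel : ∀ c d L → + 2 * ((c * L + d) * 1ℤ + 0ℤ) - + 2 * + 1 * (c * 1ℤ) * L
                       - + 1 * 1ℤ * (c * + 0 + + 2 * d) * 1ℤ ≡ 0ℤ
    cancel = solve-∀
  twiceF-top (suc j) = TopCoeffs-resp (suc j) (lead-suc j) (sublead-suc j) (twiceF-suc j)
    (TopCoeffs-recurrence j (twiceF-top j) (twiceF-degree j))

  twice-alternating-id*F : ∀ j →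
    + 2 * sumFrom1 (suc j) (λ l → sgn l * + (suc j C l) * + l * F (x l) (suc (suc j)))
    ≡ sgn (suc j) * (+ suc j * (lead j + sublead j))
  twice-alternating-id*F j =
    trans (twice-sumFrom1≡alternatingSum (suc j) (λ l → F (x l) (suc (suc j))))
          (alternatingSum-TopCoeffs (suc j) (TopCoeffs-id* j (twiceF-top j)))

shifted-sum : ∀ j (m : ℤ) →
  + 2 * sumFrom1 (suc j) (λ l → sgn l * + (suc j C l) * + l * F (+ l + m) (suc (suc j)))
  ≡ sgn (suc j) * (+ 2 * m + + suc j + + 1) * + suc j * + (suc j !)
shifted-sum j m = begin
  _ ≡⟨ AffineFibonacci.twice-alternating-id*F (λ l → + l + m) 1ℤ m (λ l → cong (_+ m) (sym (*-identityˡ (+ l)))) j ⟩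
  sgn (suc j) * (+ suc j * (+ 2 * [1+j]! * 1ℤ ^ suc j + [1+j]! * 1ℤ ^ j * (1ℤ * + j + + 2 * m)))
    ≡⟨ cong₂ (λ u v → sgn (suc j) * (+ suc j * (+ 2 * [1+j]! * u + [1+j]! * v * (1ℤ * + j + + 2 * m))))
             (^-zeroˡ (suc j)) (^-zeroˡ j) ⟩
  sgn (suc j) * (+ suc j * (+ 2 * [1+j]! * 1ℤ + [1+j]! * 1ℤ * (1ℤ * + j + + 2 * m)))
    ≡⟨ closed-form (sgn (suc j)) (+ j) [1+j]! m ⟩
  sgn (suc j) * (+ 2 * m + + suc j + + 1) * + suc j * [1+j]! ∎
  where
  open ≡-Reasoning
  [1+j]! : ℤ
  [1+j]! = + (suc j !)
  closed-form : ∀ s K F! m → s * ((1ℤ + K) * (+ 2 * F! * 1ℤ + F! * 1ℤ * (1ℤ * K + + 2 * m)))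
                           ≡ s * (+ 2 * m + (1ℤ + K) + + 1) * (1ℤ + K) * F!
  closed-form = solve-∀

scaled-sum : ∀ j (m : ℤ) →
  + 2 * sumFrom1 (suc j) (λ l → sgn l * + (suc j C l) * + l * F (+ l * m) (suc (suc j)))
  ≡ sgn (suc j) * m ^ suc j * + suc j * + (suc (suc j) !)
scaled-sum j m = begin
  _ ≡⟨ AffineFibonacci.twice-alternating-id*F (λ l → + l * m) m 0ℤ (λ l → swap (+ l) m) j ⟩
  sgn (suc j) * (+ suc j * (+ 2 * [1+j]! * (m * m ^ j) + [1+j]! * m ^ j * (m * + j + + 2 * 0ℤ)))
    ≡⟨ closed-form (sgn (suc j)) (+ j) [1+j]! m (m ^ j) ⟩
  sgn (suc j) * (m * m ^ j) * + suc j * (+ suc (suc j) * [1+j]!)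
    ≡⟨ cong (sgn (suc j) * m ^ suc j * + suc j *_) (sym (pos-* (suc (suc j)) (suc j !))) ⟩
  sgn (suc j) * m ^ suc j * + suc j * + (suc (suc j) !) ∎
  where
  open ≡-Reasoning
  [1+j]! : ℤ
  [1+j]! = + (suc j !)
  swap : ∀ L m → L * m ≡ m * L + 0ℤ
  swap = solve-∀
  closed-form : ∀ s K F! m mʲ → s * ((1ℤ + K) * (+ 2 * F! * (m * mʲ) + F! * mʲ * (m * K + + 2 * 0ℤ)))
                              ≡ s * (m * mʲ) * (1ℤ + K) * ((1ℤ + (1ℤ + K)) * F!)
  closed-form = solve-∀

proposition4p1 : (n : ℕ) → n ≥ 1 → (m : ℤ) →
    ((+ 2) * sumFrom1 n (λ l → sgn l * (+ (n C l)) * (+ l) * F ((+ l) + m) (suc n))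
      ≡ sgn n * ((+ 2) * m + (+ n) + (+ 1)) * (+ n) * (+ (n !)))
    ×
    ((+ 2) * sumFrom1 n (λ l → sgn l * (+ (n C l)) * (+ l) * F ((+ l) * m) (suc n))
      ≡ sgn n * (m ^ n) * (+ n) * (+ (suc n !)))
proposition4p1 (suc j) (s≤s z≤n) m = shifted-sum j m , scaled-sum j m
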